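{- Let $d$ and $r$ be positive integers with $1\le r\le d$, and let $X_1,\dots,X_d,Y,Z$ be indeterminates. Then $$\det_{1\le i,j\le d}\left(\begin{cases}1-\chi(r\ne j)\dfrac{Z}{X_r},& i=r\\[2mm]1-\chi(i\ne j)\dfrac{Y}{X_i},& i\ne r\end{cases}\right)=\frac{Y^{d-2}\Big(Z\sum_{i=1}^{d}X_i+(Y-Z)X_r-(d-1)YZ\Big)}{X_1X_2\cdots X_d},$$ where $\chi(\mathcal S)=1$ if $\mathcal S$ is true and $0$ otherwise.
   Context: The identity is one of rational functions in the indeterminates. -}

module Defs where

open import Level using (Level)
open import Data.Nat using (ℕ; zero; suc)
open import Data.Fin using (Fin; zero; suc; toℕ; punchIn; _≟_)
open import Data.Bool using (if_then_else_)
open import Relation.Nullary using (does)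
open import Algebra.Bundles using (CommutativeRing)

module RingDefs {c ℓ : Level} (R : CommutativeRing c ℓ) where
  open CommutativeRing R hiding (zero)

  sumF : (n : ℕ) → (Fin n → Carrier) → Carrier
  sumF zero    f = 0#
  sumF (suc n) f = f zero + sumF n (λ i → f (suc i))

  prodF : (n : ℕ) → (Fin n → Carrier) → Carrier
  prodF zero    f = 1#
  prodF (suc n) f = f zero * prodF n (λ i → f (suc i))

  pow : Carrier → ℕ → Carrier
  pow x zero    = 1#
  pow x (suc n) = x * pow x n

  natR : ℕ → Carrier
  natR zero    = 0#
  natR (suc n) = 1# + natR n

  sgn : ℕ → Carrier
  sgn zero    = 1#
  sgn (suc k) = - sgn k

  det : (n : ℕ) → (Fin n → Fin n → Carrier) → Carrier
  det zero    M = 1#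
  det (suc n) M =
    sumF (suc n) (λ j → sgn (toℕ j) * (M zero j * det n (λ a b → M (suc a) (punchIn j b))))

  chiNe : {n : ℕ} → Fin n → Fin n → Carrier
  chiNe i j = if does (i ≟ j) then 0# else 1#

-- The matrix is diag(a) + u 𝟙ᵀ with aᵢ = cᵢ Xᵢ⁻¹ and uᵢ = 1 − aᵢ, where c takes the value Z
-- at r and Y elsewhere. Expanding along the first row gives
--   det (diag a + u 𝟙ᵀ) = a₀ det (diag a′ + u′ 𝟙ᵀ) + u₀ Π a′,
-- because the cofactors of the rank-one part add up to the determinant of a matrix with a top row
-- of ones, and subtracting multiples of that row (the Laplace determinant vanishes when its first
-- two rows agree) leaves Π a′. Unwinding this recursion and clearing the denominators Xᵢ and Y
-- gives the closed form.
module Submission where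

open import Defs
open import Level using (Level)
open import Algebra.Bundles using (CommutativeRing)
open import Algebra.Solver.Ring.AlmostCommutativeRing
  using (fromCommutativeRing; _-Raw-AlmostCommutative⟶_)
open import Data.Bool using (Bool; true; false; if_then_else_)
open import Data.Fin using (Fin; zero; suc; toℕ; punchIn; lift; _≟_)
open import Data.Integer as ℤ using (ℤ; +_; -[1+_]; sign; ∣_∣; _◃_; _⊖_)
import Data.Integer.Properties as ℤ
open import Data.Maybe using (Maybe; just; nothing)
open import Data.Nat as ℕ using (ℕ; zero; suc; _∸_)
import Data.Nat.Properties as ℕ
open import Data.Sign as Sign using (Sign)
open import Function using (_∘_)
open import Relation.Binary.PropositionalEquality as ≡ using (_≡_; _≗_)
open import Relation.Nullary using (does; yes; no)

-- The ring solver needs a coefficient ring with decidable equality mapping into R;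
-- ℤ maps into every commutative ring.
module ℤ-Solver {c ℓ : Level} (R : CommutativeRing c ℓ) where
  open CommutativeRing R hiding (zero)
  open import Algebra.Properties.Ring ring using (-0#≈0#; -‿involutive; -‿+-comm; -‿distribˡ-*)
  open import Algebra.Properties.Semiring.Mult.TCOptimised semiring using (_×_; 1+×; ×-homo-+; ×1-homo-*)
  open import Algebra.Properties.CommutativeSemigroup +-commutativeSemigroup
    using () renaming (interchange to +-interchange)
  open import Algebra.Properties.CommutativeSemigroup *-commutativeSemigroup
    using () renaming (interchange to *-interchange)
  open import Relation.Binary.Reasoning.Setoid setoid

  fromℤ : ℤ → Carrier
  fromℤ (+ n)    = n × 1#
  fromℤ -[1+ n ] = - (suc n × 1#)

  fromℤ-‿ : ∀ i → fromℤ (ℤ.- i) ≈ - fromℤ i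
  fromℤ-‿ (+ zero)  = sym -0#≈0#
  fromℤ-‿ (+ suc n) = refl
  fromℤ-‿ -[1+ n ]  = sym (-‿involutive _)

  fromℤ-⊖ : ∀ m n → fromℤ (m ⊖ n) ≈ m × 1# - n × 1#
  fromℤ-⊖ m       zero    = trans (sym (+-identityʳ _)) (+-congˡ (sym -0#≈0#))
  fromℤ-⊖ zero    (suc n) = sym (+-identityˡ _)
  fromℤ-⊖ (suc m) (suc n) = begin
    fromℤ (suc m ⊖ suc n)          ≡⟨ ≡.cong fromℤ (ℤ.[1+m]⊖[1+n]≡m⊖n m n) ⟩
    fromℤ (m ⊖ n)                  ≈⟨ fromℤ-⊖ m n ⟩
    m′ - n′                        ≈⟨ +-identityˡ _ ⟨
    0# + (m′ - n′)                 ≈⟨ +-congʳ (-‿inverseʳ 1#) ⟨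
    (1# - 1#) + (m′ - n′)          ≈⟨ +-interchange 1# m′ (- 1#) (- n′) ⟨
    (1# + m′) + (- 1# - n′)        ≈⟨ +-congˡ (-‿+-comm 1# n′) ⟩
    (1# + m′) - (1# + n′)          ≈⟨ +-cong (1+× m 1#) (-‿cong (1+× n 1#)) ⟨
    suc m × 1# - suc n × 1#        ∎
    where m′ = m × 1#; n′ = n × 1#

  fromℤ-+ : ∀ i j → fromℤ (i ℤ.+ j) ≈ fromℤ i + fromℤ j
  fromℤ-+ -[1+ m ] -[1+ n ] = begin
    - (suc (suc (m ℕ.+ n)) × 1#)    ≡⟨ ≡.cong (λ k → - (suc k × 1#)) (ℕ.+-suc m n) ⟨
    - ((suc m ℕ.+ suc n) × 1#)      ≈⟨ -‿cong (×-homo-+ 1# (suc m) (suc n)) ⟩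
    - (suc m × 1# + suc n × 1#)     ≈⟨ -‿+-comm _ _ ⟨
    - (suc m × 1#) - suc n × 1#     ∎
  fromℤ-+ -[1+ m ] (+ n)    = trans (fromℤ-⊖ n (suc m)) (+-comm _ _)
  fromℤ-+ (+ m)    -[1+ n ] = fromℤ-⊖ m (suc n)
  fromℤ-+ (+ m)    (+ n)    = ×-homo-+ 1# m n

  fromSign : Sign → Carrier
  fromSign Sign.+ = 1#
  fromSign Sign.- = - 1#

  fromSign-* : ∀ s t → fromSign (s Sign.* t) ≈ fromSign s * fromSign t
  fromSign-* Sign.+ t      = sym (*-identityˡ _)
  fromSign-* Sign.- Sign.+ = sym (*-identityʳ _)
  fromSign-* Sign.- Sign.- = begin
    1#             ≈⟨ -‿involutive 1# ⟨
    - (- 1#)       ≈⟨ -‿cong (*-identityˡ (- 1#)) ⟨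
    - (1# * - 1#)  ≈⟨ -‿distribˡ-* 1# (- 1#) ⟩
    - 1# * - 1#    ∎

  fromℤ-◃ : ∀ s n → fromℤ (s ◃ n) ≈ fromSign s * (n × 1#)
  fromℤ-◃ s      zero    = sym (zeroʳ _)
  fromℤ-◃ Sign.+ (suc n) = sym (*-identityˡ _)
  fromℤ-◃ Sign.- (suc n) = trans (-‿cong (sym (*-identityˡ _))) (-‿distribˡ-* _ _)

  fromℤ≈sign*abs : ∀ i → fromℤ i ≈ fromSign (sign i) * (∣ i ∣ × 1#)
  fromℤ≈sign*abs i = trans (reflexive (≡.cong fromℤ (≡.sym (ℤ.◃-inverse i)))) (fromℤ-◃ (sign i) ∣ i ∣)

  fromℤ-* : ∀ i j → fromℤ (i ℤ.* j) ≈ fromℤ i * fromℤ j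
  fromℤ-* i j = begin
    fromℤ (sign i Sign.* sign j ◃ ∣ i ∣ ℕ.* ∣ j ∣)
      ≈⟨ fromℤ-◃ (sign i Sign.* sign j) (∣ i ∣ ℕ.* ∣ j ∣) ⟩
    fromSign (sign i Sign.* sign j) * ((∣ i ∣ ℕ.* ∣ j ∣) × 1#)
      ≈⟨ *-cong (fromSign-* (sign i) (sign j)) (×1-homo-* ∣ i ∣ ∣ j ∣) ⟩
    (fromSign (sign i) * fromSign (sign j)) * ((∣ i ∣ × 1#) * (∣ j ∣ × 1#))
      ≈⟨ *-interchange _ _ _ _ ⟩
    (fromSign (sign i) * (∣ i ∣ × 1#)) * (fromSign (sign j) * (∣ j ∣ × 1#))
      ≈⟨ *-cong (fromℤ≈sign*abs i) (fromℤ≈sign*abs j) ⟨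
    fromℤ i * fromℤ j ∎

  fromℤ-homomorphism : ℤ.+-*-rawRing -Raw-AlmostCommutative⟶ fromCommutativeRing R
  fromℤ-homomorphism = record
    { ⟦_⟧ = fromℤ ; +-homo = fromℤ-+ ; *-homo = fromℤ-* ; -‿homo = fromℤ-‿
    ; 0-homo = refl ; 1-homo = refl }

  fromℤ-≟ : ∀ i j → Maybe (fromℤ i ≈ fromℤ j)
  fromℤ-≟ i j with i ℤ.≟ j
  ... | yes ≡.refl = just refl
  ... | no _       = nothing

  open import Algebra.Solver.Ring ℤ.+-*-rawRing (fromCommutativeRing R) fromℤ-homomorphism fromℤ-≟ public

module Determinant {c ℓ : Level} (R : CommutativeRing c ℓ) where
  open CommutativeRing R hiding (zero)
  open import Algebra.Properties.Ring ring using (-0#≈0#; -‿distribˡ-*; -‿+-comm; +-inverseˡ-unique)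
  open import Relation.Binary.Reasoning.Setoid setoid
  open import Algebra.Properties.CommutativeSemigroup *-commutativeSemigroup
    using (x∙yz≈y∙xz) renaming (interchange to *-interchange)
  open RingDefs R
  open ℤ-Solver R using (solve; _:=_; _:+_; _:*_; _:-_; :-_; con)

  sumF-cong : ∀ n {f g : Fin n → Carrier} → (∀ i → f i ≈ g i) → sumF n f ≈ sumF n g
  sumF-cong zero    f≈g = refl
  sumF-cong (suc n) f≈g = +-cong (f≈g zero) (sumF-cong n (f≈g ∘ suc))

  sumF-distrib-+ : ∀ n (f g : Fin n → Carrier) → sumF n (λ i → f i + g i) ≈ sumF n f + sumF n g
  sumF-distrib-+ zero    f g = sym (+-identityˡ 0#)
  sumF-distrib-+ (suc n) f g = trans (+-congˡ (sumF-distrib-+ n (f ∘ suc) (g ∘ suc)))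
    (solve 4 (λ a b s t → (a :+ b) :+ (s :+ t) := (a :+ s) :+ (b :+ t)) refl
      (f zero) (g zero) (sumF n (f ∘ suc)) (sumF n (g ∘ suc)))

  sumF-‿ : ∀ n (f : Fin n → Carrier) → sumF n (λ i → - f i) ≈ - sumF n f
  sumF-‿ zero    f = sym -0#≈0#
  sumF-‿ (suc n) f = trans (+-congˡ (sumF-‿ n (f ∘ suc))) (-‿+-comm _ _)

  *-distribˡ-sumF : ∀ n a (f : Fin n → Carrier) → a * sumF n f ≈ sumF n (λ i → a * f i)
  *-distribˡ-sumF zero    a f = zeroʳ a
  *-distribˡ-sumF (suc n) a f = trans (distribˡ _ _ _) (+-congˡ (*-distribˡ-sumF n a (f ∘ suc)))

  altSum : (n : ℕ) → (Fin n → Carrier) → Carrier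
  altSum n f = sumF n (λ j → sgn (toℕ j) * f j)

  altSum-cong : ∀ n {f g : Fin n → Carrier} → (∀ i → f i ≈ g i) → altSum n f ≈ altSum n g
  altSum-cong n f≈g = sumF-cong n (λ j → *-congˡ (f≈g j))

  altSum-suc : ∀ n (f : Fin (suc n) → Carrier) → altSum (suc n) f ≈ f zero - altSum n (f ∘ suc)
  altSum-suc n f = +-cong (*-identityˡ (f zero)) (begin
    sumF n (λ j → - sgn (toℕ j) * f (suc j))    ≈⟨ sumF-cong n (λ j → -‿distribˡ-* _ _) ⟨
    sumF n (λ j → - (sgn (toℕ j) * f (suc j)))  ≈⟨ sumF-‿ n _ ⟩
    - altSum n (f ∘ suc)                         ∎)

  altSum-distrib-+ : ∀ n (f g : Fin n → Carrier) → altSum n (λ i → f i + g i) ≈ altSum n f + altSum n g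
  altSum-distrib-+ n f g =
    trans (sumF-cong n (λ j → distribˡ _ _ _)) (sumF-distrib-+ n _ _)

  *-distribˡ-altSum : ∀ n a (f : Fin n → Carrier) → a * altSum n f ≈ altSum n (λ i → a * f i)
  *-distribˡ-altSum n a f =
    trans (*-distribˡ-sumF n a _) (sumF-cong n (λ j → x∙yz≈y∙xz a (sgn (toℕ j)) (f j)))

  δ : ∀ {n} → Fin n → Fin n → Carrier
  δ i j = if does (i ≟ j) then 1# else 0#

  altSum-δ : ∀ n (k : Fin n) (f : Fin n → Carrier) → altSum n (λ j → δ k j * f j) ≈ sgn (toℕ k) * f k
  altSum-δ (suc n) zero f = begin
    altSum (suc n) (λ j → δ zero j * f j)     ≈⟨ altSum-suc n (λ j → δ zero j * f j) ⟩
    1# * f zero - altSum n (λ j → 0# * f (suc j))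
      ≈⟨ +-congˡ (-‿cong (*-distribˡ-altSum n 0# (f ∘ suc))) ⟨
    1# * f zero - 0# * altSum n (f ∘ suc)
      ≈⟨ solve 2 (λ x s → con (+ 1) :* x :- con (+ 0) :* s := con (+ 1) :* x) refl (f zero) _ ⟩
    1# * f zero                               ∎
  altSum-δ (suc n) (suc k) f = begin
    altSum (suc n) (λ j → δ (suc k) j * f j)  ≈⟨ altSum-suc n (λ j → δ (suc k) j * f j) ⟩
    0# * f zero - altSum n (λ j → δ k j * f (suc j))
      ≈⟨ +-congˡ (-‿cong (altSum-δ n k (f ∘ suc))) ⟩
    0# * f zero - sgn (toℕ k) * f (suc k)
      ≈⟨ solve 3 (λ x s y → con (+ 0) :* x :- s :* y := (:- s) :* y) refl (f zero) (sgn (toℕ k)) _ ⟩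
    - sgn (toℕ k) * f (suc k)                 ∎

  det-cong : ∀ n {M N : Fin n → Fin n → Carrier} → (∀ i j → M i j ≈ N i j) → det n M ≈ det n N
  det-cong zero    M≈N = refl
  det-cong (suc n) M≈N = altSum-cong (suc n) (λ j →
    *-cong (M≈N zero j) (det-cong n (λ a b → M≈N (suc a) (punchIn j b))))

  inner₂ : ∀ n → (y : Fin (suc n) → Carrier) → (Fin (suc n) → Fin n → Carrier) → Fin (suc n) → Carrier
  inner₂ n y H j = altSum n (λ k → y (punchIn j k) * H j k)

  expand₂ : ∀ n → (x y : Fin (suc n) → Carrier) → (Fin (suc n) → Fin n → Carrier) → Carrier
  expand₂ n x y H = altSum (suc n) (λ j → x j * inner₂ n y H j)

  minor₂ : ∀ {n} → ((Fin n → Fin (suc (suc n))) → Carrier) → Fin (suc (suc n)) → Fin (suc n) → Carrier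
  minor₂ G j k = G (punchIn j ∘ punchIn k)

  Extensional : ∀ {m n} → ((Fin m → Fin n) → Carrier) → Set ℓ
  Extensional G = ∀ {σ τ} → σ ≗ τ → G σ ≈ G τ

  det-columns-extensional : ∀ m {n} (M : Fin m → Fin n → Carrier) →
                            Extensional (λ τ → det m (λ p q → M p (τ q)))
  det-columns-extensional m M σ≗τ = det-cong m (λ p q → reflexive (≡.cong (M p) (σ≗τ q)))

  expand₂-cong : ∀ n {x x′ y y′ : Fin (suc n) → Carrier} {H H′ : Fin (suc n) → Fin n → Carrier} →
                 (∀ i → x i ≈ x′ i) → (∀ i → y i ≈ y′ i) → (∀ j k → H j k ≈ H′ j k) →
                 expand₂ n x y H ≈ expand₂ n x′ y′ H′
  expand₂-cong n x≈x′ y≈y′ H≈H′ = altSum-cong (suc n) (λ j →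
    *-cong (x≈x′ j) (altSum-cong n (λ k → *-cong (y≈y′ (punchIn j k)) (H≈H′ j k))))

  expand₂-+ˡ : ∀ n (x x′ y : Fin (suc n) → Carrier) H →
               expand₂ n (λ i → x i + x′ i) y H ≈ expand₂ n x y H + expand₂ n x′ y H
  expand₂-+ˡ n x x′ y H = trans
    (altSum-cong (suc n) (λ j → distribʳ (inner₂ n y H j) (x j) (x′ j)))
    (altSum-distrib-+ (suc n) (λ j → x j * inner₂ n y H j) (λ j → x′ j * inner₂ n y H j))

  expand₂-+ʳ : ∀ n (x y y′ : Fin (suc n) → Carrier) H →
               expand₂ n x (λ i → y i + y′ i) H ≈ expand₂ n x y H + expand₂ n x y′ H
  expand₂-+ʳ n x y y′ H = trans
    (altSum-cong (suc n) (λ j → trans (*-congˡ (inner₂-+ j)) (distribˡ (x j) _ _)))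
    (altSum-distrib-+ (suc n) (λ j → x j * inner₂ n y H j) (λ j → x j * inner₂ n y′ H j))
    where
    inner₂-+ : ∀ j → inner₂ n (λ i → y i + y′ i) H j ≈ inner₂ n y H j + inner₂ n y′ H j
    inner₂-+ j = trans
      (altSum-cong n (λ k → distribʳ (H j k) (y (punchIn j k)) (y′ (punchIn j k))))
      (altSum-distrib-+ n (λ k → y (punchIn j k) * H j k) (λ k → y′ (punchIn j k) * H j k))

  expand₂-*ʳ : ∀ n (x : Fin (suc n) → Carrier) a y H →
               expand₂ n x (λ i → a * y i) H ≈ a * expand₂ n x y H
  expand₂-*ʳ n x a y H = trans
    (altSum-cong (suc n) (λ j → trans (*-congˡ (inner₂-* j)) (x∙yz≈y∙xz (x j) a (inner₂ n y H j))))
    (sym (*-distribˡ-altSum (suc n) a (λ j → x j * inner₂ n y H j)))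
    where
    inner₂-* : ∀ j → inner₂ n (λ i → a * y i) H j ≈ a * inner₂ n y H j
    inner₂-* j = trans
      (altSum-cong n (λ k → *-assoc a (y (punchIn j k)) (H j k)))
      (sym (*-distribˡ-altSum n a (λ k → y (punchIn j k) * H j k)))

  -- Expanding both rows and splitting off the terms through column 0: the two
  -- families that meet column 0 cancel, which is where the symmetry of H enters.
  expand₂-equal-rows-suc : ∀ n (r : Fin (suc (suc n)) → Carrier) H → (∀ j → H zero j ≈ H (suc j) zero) →
                           expand₂ (suc n) r r H ≈ expand₂ n (r ∘ suc) (r ∘ suc) (λ j k → H (suc j) (suc k))
  expand₂-equal-rows-suc n r H H-sym = begin
    expand₂ (suc n) r r H
      ≈⟨ altSum-suc (suc n) (λ j → r j * altSum (suc n) (λ k → r (punchIn j k) * H j k)) ⟩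
    r zero * A - altSum (suc n) (λ j → r (suc j) * altSum (suc n) (λ k → r (punchIn (suc j) k) * H (suc j) k))
      ≈⟨ +-congˡ (-‿cong (altSum-cong (suc n) (λ j → *-congˡ {r (suc j)} (altSum-suc n (λ k → r (punchIn (suc j) k) * H (suc j) k))))) ⟩
    r zero * A - altSum (suc n) (λ j → r (suc j) * (r zero * H (suc j) zero - W j))
      ≈⟨ +-congˡ (-‿cong (altSum-cong (suc n) (λ j →
           solve 4 (λ x r₀ h w → x :* (r₀ :* h :- w) := r₀ :* (x :* h) :+ :- con (+ 1) :* (x :* w)) refl
             (r (suc j)) (r zero) (H (suc j) zero) (W j)))) ⟩
    r zero * A - altSum (suc n) (λ j → r zero * (r (suc j) * H (suc j) zero) + - 1# * (r (suc j) * W j))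
      ≈⟨ +-congˡ (-‿cong (trans (altSum-distrib-+ (suc n) (λ j → r zero * B j) (λ j → - 1# * (r (suc j) * W j)))
           (+-cong (sym (*-distribˡ-altSum (suc n) (r zero) B))
                   (sym (*-distribˡ-altSum (suc n) (- 1#) (λ j → r (suc j) * W j)))))) ⟩
    r zero * A - (r zero * altSum (suc n) B + - 1# * S)
      ≈⟨ +-congˡ (-‿cong (+-congʳ (*-congˡ (altSum-cong (suc n) (λ j → *-congˡ {r (suc j)} (sym (H-sym j))))))) ⟩
    r zero * A - (r zero * A + - 1# * S)
      ≈⟨ solve 3 (λ r₀ a s → r₀ :* a :- (r₀ :* a :+ :- con (+ 1) :* s) := s) refl (r zero) A S ⟩
    S ∎
    where
    A = altSum (suc n) (λ k → r (suc k) * H zero k)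
    B : Fin (suc n) → Carrier
    B j = r (suc j) * H (suc j) zero
    W : Fin (suc n) → Carrier
    W j = altSum n (λ k → r (suc (punchIn j k)) * H (suc j) (suc k))
    S = expand₂ n (r ∘ suc) (r ∘ suc) (λ j k → H (suc j) (suc k))

  expand₂-equal-rows : ∀ n (r : Fin (suc (suc n)) → Carrier) G → Extensional G →
                       expand₂ (suc n) r r (minor₂ G) ≈ 0#
  expand₂-equal-rows zero r G G-ext = trans (expand₂-equal-rows-suc zero r (minor₂ G) (λ _ → refl))
    (solve 1 (λ x → con (+ 1) :* (x :* con (+ 0)) :+ con (+ 0) := con (+ 0)) refl (r (suc zero)))
  expand₂-equal-rows (suc m) r G G-ext = begin
    expand₂ (suc (suc m)) r r (minor₂ G)
      ≈⟨ expand₂-equal-rows-suc (suc m) r (minor₂ G) (λ _ → refl) ⟩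
    expand₂ (suc m) (r ∘ suc) (r ∘ suc) (λ j k → minor₂ G (suc j) (suc k))
      ≈⟨ expand₂-cong (suc m) {r ∘ suc} {r ∘ suc} {r ∘ suc} {r ∘ suc}
           {λ j k → minor₂ G (suc j) (suc k)} {minor₂ (G ∘ lift 1)}
           (λ _ → refl) (λ _ → refl) (λ j k → G-ext λ { zero → ≡.refl ; (suc b) → ≡.refl }) ⟩
    expand₂ (suc m) (r ∘ suc) (r ∘ suc) (minor₂ (G ∘ lift 1))
      ≈⟨ expand₂-equal-rows m (r ∘ suc) (G ∘ lift 1)
           (λ σ≗τ → G-ext λ { zero → ≡.refl ; (suc b) → ≡.cong suc (σ≗τ b) }) ⟩
    0# ∎

  expand₂-swap : ∀ n (x y : Fin (suc (suc n)) → Carrier) G → Extensional G →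
                 expand₂ (suc n) x y (minor₂ G) ≈ - expand₂ (suc n) y x (minor₂ G)
  expand₂-swap n x y G G-ext = +-inverseˡ-unique _ _ (begin
    e x y + e y x
      ≈⟨ +-cong (+-identityˡ _) (+-identityʳ _) ⟨
    (0# + e x y) + (e y x + 0#)
      ≈⟨ +-cong (+-congʳ (equal x)) (+-congˡ (equal y)) ⟨
    (e x x + e x y) + (e y x + e y y)
      ≈⟨ +-cong (expand₂-+ʳ (suc n) x x y (minor₂ G)) (expand₂-+ʳ (suc n) y x y (minor₂ G)) ⟨
    e x s + e y s
      ≈⟨ expand₂-+ˡ (suc n) x y s (minor₂ G) ⟨
    e s s
      ≈⟨ equal s ⟩
    0# ∎)
    where
    e : (Fin (suc (suc n)) → Carrier) → (Fin (suc (suc n)) → Carrier) → Carrier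
    e x y = expand₂ (suc n) x y (minor₂ G)
    s : Fin (suc (suc n)) → Carrier
    s i = x i + y i
    equal : ∀ r → e r r ≈ 0#
    equal r = expand₂-equal-rows n r G G-ext

  bordered : ∀ n → (a u : Fin n → Carrier) → Fin (suc n) → Fin (suc n) → Carrier
  bordered n a u zero    j = 1#
  bordered n a u (suc i) j = a i * δ (suc i) j + u i

  bordered-punchIn₁ : ∀ n (a u : Fin (suc n) → Carrier) i j →
    bordered (suc n) a u (suc (suc i)) (punchIn (suc zero) j) ≡ bordered n (a ∘ suc) (u ∘ suc) (suc i) j
  bordered-punchIn₁ n a u i zero    = ≡.refl
  bordered-punchIn₁ n a u i (suc j) = ≡.refl

  -- Row i+1 is a i times a unit vector plus u i times the top row of ones; the
  -- second summand contributes nothing as the top two rows then agree.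
  det-bordered : ∀ n (a u : Fin n → Carrier) → det (suc n) (bordered n a u) ≈ prodF n a
  det-bordered zero    a u = solve 0 (con (+ 1) :* (con (+ 1) :* con (+ 1)) :+ con (+ 0) := con (+ 1)) refl
  det-bordered (suc m) a u = begin
    expand₂ (suc m) one (λ j → a zero * δ (suc zero) j + u zero) (minor₂ G)
      ≈⟨ expand₂-cong (suc m) {one} {one} {λ j → a zero * δ (suc zero) j + u zero}
           {λ j → a zero * δ (suc zero) j + u zero * one j} {minor₂ G} {minor₂ G}
           (λ _ → refl) (λ j → +-congˡ (sym (*-identityʳ (u zero)))) (λ _ _ → refl) ⟩
    expand₂ (suc m) one (λ j → a zero * δ (suc zero) j + u zero * one j) (minor₂ G)
      ≈⟨ expand₂-+ʳ (suc m) one (λ j → a zero * δ (suc zero) j) (λ j → u zero * one j) (minor₂ G) ⟩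
    expand₂ (suc m) one (λ j → a zero * δ (suc zero) j) (minor₂ G) + expand₂ (suc m) one (λ j → u zero * one j) (minor₂ G)
      ≈⟨ +-cong (expand₂-*ʳ (suc m) one (a zero) (δ (suc zero)) (minor₂ G)) (expand₂-*ʳ (suc m) one (u zero) one (minor₂ G)) ⟩
    a zero * expand₂ (suc m) one (δ (suc zero)) (minor₂ G) + u zero * expand₂ (suc m) one one (minor₂ G)
      ≈⟨ +-cong (*-congˡ (expand₂-swap m one (δ (suc zero)) G G-ext)) (*-congˡ (expand₂-equal-rows m one G G-ext)) ⟩
    a zero * - expand₂ (suc m) (δ (suc zero)) one (minor₂ G) + u zero * 0#
      ≈⟨ +-congʳ (*-congˡ (-‿cong (altSum-δ (suc (suc m)) (suc zero) (inner₂ (suc m) one (minor₂ G))))) ⟩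
    a zero * - (- 1# * inner₂ (suc m) one (minor₂ G) (suc zero)) + u zero * 0#
      ≈⟨ +-congʳ (*-congˡ (-‿cong (*-congˡ (trans inner≈det (det-bordered m (a ∘ suc) (u ∘ suc)))))) ⟩
    a zero * - (- 1# * prodF m (a ∘ suc)) + u zero * 0#
      ≈⟨ solve 3 (λ x p y → x :* :- (:- con (+ 1) :* p) :+ y :* con (+ 0) := x :* p) refl (a zero) (prodF m (a ∘ suc)) (u zero) ⟩
    a zero * prodF m (a ∘ suc) ∎
    where
    one : Fin (suc (suc m)) → Carrier
    one _ = 1#
    G : (Fin m → Fin (suc (suc m))) → Carrier
    G τ = det m (λ p q → bordered (suc m) a u (suc (suc p)) (τ q))
    G-ext : Extensional G
    G-ext = det-columns-extensional m (λ p → bordered (suc m) a u (suc (suc p)))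
    inner≈det : inner₂ (suc m) one (minor₂ G) (suc zero) ≈ det (suc m) (bordered m (a ∘ suc) (u ∘ suc))
    inner≈det = altSum-cong (suc m) (λ k → *-congˡ {1#} (det-cong m (λ p q →
      reflexive (bordered-punchIn₁ m a u p (punchIn k q)))))

  diagPlusRankOne : ∀ {n} → (a u : Fin n → Carrier) → Fin n → Fin n → Carrier
  diagPlusRankOne a u i j = a i * δ i j + u i

  det-diagPlusRankOne-suc : ∀ n (a u : Fin (suc n) → Carrier) →
    det (suc n) (diagPlusRankOne a u)
      ≈ a zero * det n (diagPlusRankOne (a ∘ suc) (u ∘ suc)) + u zero * prodF n (a ∘ suc)
  det-diagPlusRankOne-suc n a u = begin
    altSum (suc n) (λ j → (a zero * δ zero j + u zero) * K j)
      ≈⟨ altSum-cong (suc n) (λ j → distribʳ (K j) (a zero * δ zero j) (u zero)) ⟩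
    altSum (suc n) (λ j → a zero * δ zero j * K j + u zero * K j)
      ≈⟨ altSum-distrib-+ (suc n) (λ j → a zero * δ zero j * K j) (λ j → u zero * K j) ⟩
    altSum (suc n) (λ j → a zero * δ zero j * K j) + altSum (suc n) (λ j → u zero * K j)
      ≈⟨ +-cong (altSum-cong (suc n) (λ j → *-assoc (a zero) (δ zero j) (K j))) refl ⟩
    altSum (suc n) (λ j → a zero * (δ zero j * K j)) + altSum (suc n) (λ j → u zero * K j)
      ≈⟨ +-cong (*-distribˡ-altSum (suc n) (a zero) (λ j → δ zero j * K j)) (*-distribˡ-altSum (suc n) (u zero) K) ⟨
    a zero * altSum (suc n) (λ j → δ zero j * K j) + u zero * altSum (suc n) K
      ≈⟨ +-cong (*-congˡ (trans (altSum-δ (suc n) zero K) (*-identityˡ (K zero)))) (*-congˡ altSum-minors) ⟩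
    a zero * K zero + u zero * prodF n (a ∘ suc) ∎
    where
    K : Fin (suc n) → Carrier
    K j = det n (λ p q → diagPlusRankOne a u (suc p) (punchIn j q))
    altSum-minors : altSum (suc n) K ≈ prodF n (a ∘ suc)
    altSum-minors = trans (altSum-cong (suc n) (λ j → sym (*-identityˡ (K j))))
                          (det-bordered n (a ∘ suc) (u ∘ suc))

  prodF-distrib-* : ∀ n (f g : Fin n → Carrier) → prodF n (λ i → f i * g i) ≈ prodF n f * prodF n g
  prodF-distrib-* zero    f g = sym (*-identityˡ 1#)
  prodF-distrib-* (suc n) f g = trans (*-congˡ (prodF-distrib-* n (f ∘ suc) (g ∘ suc)))
    (*-interchange (f zero) (g zero) (prodF n (f ∘ suc)) (prodF n (g ∘ suc)))

  prodF-const : ∀ n y → prodF n (λ _ → y) ≈ pow y n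
  prodF-const zero    y = refl
  prodF-const (suc n) y = *-congˡ (prodF-const n y)

  -- det (diag a + u 𝟙ᵀ) = Π a + Σᵢ uᵢ Πₖ≠ᵢ aₖ; with aᵢ = cᵢ/Xᵢ and uᵢ = 1 − aᵢ it is
  -- Πᵢ Xᵢ⁻¹ times this polynomial.
  numerator : ∀ n → (c X : Fin n → Carrier) → Carrier
  numerator zero    c X = 1#
  numerator (suc n) c X = c zero * numerator n (c ∘ suc) (X ∘ suc) + (X zero - c zero) * prodF n (c ∘ suc)

  det-numerator : ∀ n (c X x : Fin n → Carrier) → (∀ i → X i * x i ≈ 1#) →
    det n (diagPlusRankOne (λ i → c i * x i) (λ i → 1# - c i * x i)) ≈ numerator n c X * prodF n x
  det-numerator zero    c X x X*x≈1 = sym (*-identityˡ 1#)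
  det-numerator (suc n) c X x X*x≈1 = begin
    det (suc n) (diagPlusRankOne (λ i → c i * x i) (λ i → 1# - c i * x i))
      ≈⟨ det-diagPlusRankOne-suc n (λ i → c i * x i) (λ i → 1# - c i * x i) ⟩
    (c zero * x zero) * det n (diagPlusRankOne (λ i → c (suc i) * x (suc i)) (λ i → 1# - c (suc i) * x (suc i)))
      + (1# - c zero * x zero) * prodF n (λ i → c (suc i) * x (suc i))
      ≈⟨ +-cong (*-congˡ (det-numerator n (c ∘ suc) (X ∘ suc) (x ∘ suc) (X*x≈1 ∘ suc)))
                (*-cong (+-congʳ (sym (X*x≈1 zero))) (prodF-distrib-* n (c ∘ suc) (x ∘ suc))) ⟩
    (c zero * x zero) * (N * P) + (X zero * x zero - c zero * x zero) * (C * P)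
      ≈⟨ solve 6 (λ c₀ x₀ N P X₀ C → (c₀ :* x₀) :* (N :* P) :+ (X₀ :* x₀ :- c₀ :* x₀) :* (C :* P)
                   := (c₀ :* N :+ (X₀ :- c₀) :* C) :* (x₀ :* P)) refl (c zero) (x zero) N P (X zero) C ⟩
    (c zero * N + (X zero - c zero) * C) * (x zero * P) ∎
    where
    N = numerator n (c ∘ suc) (X ∘ suc)
    P = prodF n (x ∘ suc)
    C = prodF n (c ∘ suc)

  numerator-const : ∀ n (X : Fin n → Carrier) y →
    y * numerator n (λ _ → y) X ≈ pow y n * (sumF n X + y - natR n * y)
  numerator-const zero    X y = solve 1 (λ y → y :* con (+ 1) := con (+ 1) :* (con (+ 0) :+ y :- con (+ 0) :* y)) refl y
  numerator-const (suc n) X y = begin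
    y * (y * N + (X zero - y) * prodF n (λ _ → y))
      ≈⟨ solve 4 (λ y N x₀ p → y :* (y :* N :+ (x₀ :- y) :* p) := y :* (y :* N) :+ y :* ((x₀ :- y) :* p)) refl
           y N (X zero) (prodF n (λ _ → y)) ⟩
    y * (y * N) + y * ((X zero - y) * prodF n (λ _ → y))
      ≈⟨ +-cong (*-congˡ (numerator-const n (X ∘ suc) y)) (*-congˡ (*-congˡ (prodF-const n y))) ⟩
    y * (pow y n * (S + y - natR n * y)) + y * ((X zero - y) * pow y n)
      ≈⟨ solve 5 (λ y p S x₀ k → y :* (p :* (S :+ y :- k :* y)) :+ y :* ((x₀ :- y) :* p)
                   := (y :* p) :* ((x₀ :+ S) :+ y :- (con (+ 1) :+ k) :* y)) refl y (pow y n) S (X zero) (natR n) ⟩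
    pow y (suc n) * (sumF (suc n) X + y - natR (suc n) * y) ∎
    where
    N = numerator n (λ _ → y) (X ∘ suc)
    S = sumF n (X ∘ suc)

  constExceptAt : ∀ {n} → Fin n → Carrier → Carrier → Fin n → Carrier
  constExceptAt r y z i = if does (i ≟ r) then z else y

  prodF-constExceptAt : ∀ m (r : Fin (suc m)) y z → prodF (suc m) (constExceptAt r y z) ≈ z * pow y m
  prodF-constExceptAt m       zero    y z = *-congˡ (prodF-const m y)
  prodF-constExceptAt (suc m) (suc r) y z = trans (*-congˡ (prodF-constExceptAt m r y z)) (x∙yz≈y∙xz y z (pow y m))

  numerator-constExceptAt : ∀ n (r : Fin (suc n)) (X : Fin (suc n) → Carrier) y z →
    y * numerator (suc n) (constExceptAt r y z) X
      ≈ pow y n * (z * sumF (suc n) X + (y - z) * X r - natR n * (y * z))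
  numerator-constExceptAt n zero X y z = begin
    y * (z * N + (X zero - z) * prodF n (λ _ → y))
      ≈⟨ solve 5 (λ y z N x₀ p → y :* (z :* N :+ (x₀ :- z) :* p) := z :* (y :* N) :+ y :* ((x₀ :- z) :* p)) refl
           y z N (X zero) (prodF n (λ _ → y)) ⟩
    z * (y * N) + y * ((X zero - z) * prodF n (λ _ → y))
      ≈⟨ +-cong (*-congˡ (numerator-const n (X ∘ suc) y)) (*-congˡ (*-congˡ (prodF-const n y))) ⟩
    z * (pow y n * (S + y - natR n * y)) + y * ((X zero - z) * pow y n)
      ≈⟨ solve 6 (λ y z p S x₀ k → z :* (p :* (S :+ y :- k :* y)) :+ y :* ((x₀ :- z) :* p)
                   := p :* (z :* (x₀ :+ S) :+ (y :- z) :* x₀ :- k :* (y :* z))) refl y z (pow y n) S (X zero) (natR n) ⟩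
    pow y n * (z * sumF (suc n) X + (y - z) * X zero - natR n * (y * z)) ∎
    where
    N = numerator n (λ _ → y) (X ∘ suc)
    S = sumF n (X ∘ suc)
  numerator-constExceptAt (suc m) (suc r) X y z = begin
    y * (y * N + (X zero - y) * prodF (suc m) (constExceptAt r y z))
      ≈⟨ solve 4 (λ y N x₀ p → y :* (y :* N :+ (x₀ :- y) :* p) := y :* (y :* N) :+ y :* ((x₀ :- y) :* p)) refl
           y N (X zero) (prodF (suc m) (constExceptAt r y z)) ⟩
    y * (y * N) + y * ((X zero - y) * prodF (suc m) (constExceptAt r y z))
      ≈⟨ +-cong (*-congˡ (numerator-constExceptAt m r (X ∘ suc) y z)) (*-congˡ (*-congˡ (prodF-constExceptAt m r y z))) ⟩
    y * (pow y m * (z * S + (y - z) * X (suc r) - natR m * (y * z))) + y * ((X zero - y) * (z * pow y m))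
      ≈⟨ solve 7 (λ y z p S x₀ xᵣ k → y :* (p :* (z :* S :+ (y :- z) :* xᵣ :- k :* (y :* z))) :+ y :* ((x₀ :- y) :* (z :* p))
                   := (y :* p) :* (z :* (x₀ :+ S) :+ (y :- z) :* xᵣ :- (con (+ 1) :+ k) :* (y :* z))) refl
           y z (pow y m) S (X zero) (X (suc r)) (natR m) ⟩
    pow y (suc m) * (z * sumF (suc (suc m)) X + (y - z) * X (suc r) - natR (suc m) * (y * z)) ∎
    where
    N = numerator (suc m) (constExceptAt r y z) (X ∘ suc)
    S = sumF (suc m) (X ∘ suc)

  1-χ*a≈a*δ+[1-a] : ∀ (b : Bool) a → 1# - (if b then 0# else 1#) * a ≈ a * (if b then 1# else 0#) + (1# - a)
  1-χ*a≈a*δ+[1-a] true  a = solve 1 (λ a → con (+ 1) :- con (+ 0) :* a := a :* con (+ 1) :+ (con (+ 1) :- a)) refl a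
  1-χ*a≈a*δ+[1-a] false a = solve 1 (λ a → con (+ 1) :- con (+ 1) :* a := a :* con (+ 0) :+ (con (+ 1) :- a)) refl a

corollary1 : {c ℓ : Level} (R : CommutativeRing c ℓ) →
    let open CommutativeRing R
        open RingDefs R
    in (d : ℕ) (r : Fin d)
       (X Xinv : Fin d → Carrier) → (∀ i → X i * Xinv i ≈ 1#) →
       (Y Yinv : Carrier) → Y * Yinv ≈ 1# →
       (Z : Carrier) →
       det d (λ i j → if does (i ≟ r)
                        then 1# - chiNe r j * (Z * Xinv r)
                        else 1# - chiNe i j * (Y * Xinv i))
       ≈ (Yinv * pow Y (d ∸ 1))
         * ((Z * sumF d X + (Y - Z) * X r - natR (d ∸ 1) * (Y * Z))
            * prodF d Xinv)
corollary1 R (suc n) r X Xinv X*Xinv≈1 Y Yinv Y*Yinv≈1 Z = begin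
  det (suc n) (λ i j → if does (i ≟ r) then 1# - chiNe r j * (Z * Xinv r) else 1# - chiNe i j * (Y * Xinv i))
    ≈⟨ det-cong (suc n) entry ⟩
  det (suc n) (diagPlusRankOne (λ i → c i * Xinv i) (λ i → 1# - c i * Xinv i))
    ≈⟨ det-numerator (suc n) c X Xinv X*Xinv≈1 ⟩
  N * P
    ≈⟨ *-identityˡ (N * P) ⟨
  1# * (N * P)
    ≈⟨ *-congʳ Y*Yinv≈1 ⟨
  (Y * Yinv) * (N * P)
    ≈⟨ solve 4 (λ y y⁻¹ N P → (y :* y⁻¹) :* (N :* P) := y⁻¹ :* ((y :* N) :* P)) refl Y Yinv N P ⟩
  Yinv * ((Y * N) * P)
    ≈⟨ *-congˡ (*-congʳ (numerator-constExceptAt n r X Y Z)) ⟩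
  Yinv * ((pow Y n * T) * P)
    ≈⟨ solve 4 (λ y⁻¹ p T P → y⁻¹ :* ((p :* T) :* P) := (y⁻¹ :* p) :* (T :* P)) refl Yinv (pow Y n) T P ⟩
  (Yinv * pow Y n) * (T * P) ∎
  where
  open CommutativeRing R
  open RingDefs R
  open Determinant R
  open ℤ-Solver R using (solve; _:=_; _:*_)
  open import Relation.Binary.Reasoning.Setoid setoid
  c = constExceptAt r Y Z
  N = numerator (suc n) c X
  P = prodF (suc n) Xinv
  T = Z * sumF (suc n) X + (Y - Z) * X r - natR n * (Y * Z)
  entry : ∀ i j → (if does (i ≟ r) then 1# - chiNe r j * (Z * Xinv r) else 1# - chiNe i j * (Y * Xinv i))
                  ≈ diagPlusRankOne (λ i → c i * Xinv i) (λ i → 1# - c i * Xinv i) i j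
  entry i j with i ≟ r
  ... | yes ≡.refl = 1-χ*a≈a*δ+[1-a] (does (r ≟ j)) (Z * Xinv r)
  ... | no _       = 1-χ*a≈a*δ+[1-a] (does (i ≟ j)) (Y * Xinv i)
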